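{- Let $k\in\mathbb N$ and $A\subseteq\mathbb Z_{2k}\setminus\{0\}$ with $A=-A$, and suppose $C_{2k}(A)$ is twin-free. Then $C_{2k}(A)$ has co-twins if and only if $k\notin A$, $|A|=k-1$, and $k+a\in\overline A$ for all $a\in A$, where $\overline A=(\mathbb Z_{2k}\setminus\{0\})\setminus A$.
   Context: The circulant graph $C_n(A)$ has vertex set $\mathbb Z_n$, with $u,v$ adjacent iff $u-v\in A$. A graph is twin-free if it has no two distinct vertices $u,v$ with $N(u)=N(v)$ and no two distinct vertices with $N[u]=N[v]$ ($N(\cdot)$ open, $N[\cdot]$ closed neighborhood). Here "co-twins" means nonadjacent co-twins: distinct vertices $u,v$ with $N[u]\cap N[v]=\emptyset$ and $N[u]\cup N[v]$ equal to the whole vertex set. -}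

module Defs where

open import Data.Nat using (ℕ; zero; suc; _+_; _*_; _∸_; NonZero; _<_)
open import Data.Nat.DivMod using (_mod_)
open import Data.Fin using (Fin; toℕ)
open import Data.Fin.Subset using (Subset; _∈_; _∉_)
open import Data.Product using (_×_; ∃-syntax)
open import Data.Sum using (_⊎_)
open import Relation.Binary.PropositionalEquality using (_≡_; _≢_)
open import Relation.Nullary using (¬_)
open import Function.Bundles using (_⇔_)

-- Z_n is represented by Fin n (n ≥ 1), with arithmetic mod n.
module _ {n : ℕ} .{{_ : NonZero n}} where

  [_] : ℕ → Fin n
  [ m ] = m mod n

  _⊖_ : Fin n → Fin n → Fin n
  u ⊖ v = [ toℕ u + (n ∸ toℕ v) ]

  ⊝_ : Fin n → Fin n
  ⊝ u = [ n ∸ toℕ u ]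

  _⊕_ : Fin n → Fin n → Fin n
  u ⊕ v = [ toℕ u + toℕ v ]

  Adj : Subset n → Fin n → Fin n → Set
  Adj A u v = (u ⊖ v) ∈ A

  InClosedNbhd : Subset n → Fin n → Fin n → Set
  InClosedNbhd A u w = (w ≡ u) ⊎ Adj A u w

  TwinFree : Subset n → Set
  TwinFree A =
    (∀ u v → u ≢ v → ¬ (∀ w → Adj A u w ⇔ Adj A v w)) ×
    (∀ u v → u ≢ v → ¬ (∀ w → InClosedNbhd A u w ⇔ InClosedNbhd A v w))

  HasCoTwins : Subset n → Set
  HasCoTwins A = ∃[ u ] ∃[ v ] (u ≢ v ×
    (∀ w → ¬ (InClosedNbhd A u w × InClosedNbhd A v w)) ×
    (∀ w → InClosedNbhd A u w ⊎ InClosedNbhd A v w))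

  InCompl : Subset n → Fin n → Set
  InCompl A x = (x ≢ [ 0 ]) × (x ∉ A)

instance
  nonZero-2* : ∀ {k : ℕ} → .{{NonZero k}} → NonZero (2 * k)
  nonZero-2* {suc m} = _

{-# OPTIONS --safe #-}
-- Put S = A ∪ {0}, so that N[u] = u − S. Two vertices u and u + d are co-twins exactly
-- when S and its translate S − d partition ℤ_2k. Then S is invariant under translation
-- by 2d, hence N[0] = N[2d], and twin-freeness forces 2d = 0; as d ≠ 0 (0 ∈ S), d = k.
-- For d = k, disjointness of S and S − k says that k ∉ A and k + A ⊆ Ā, and once S meets
-- each of the k pairs {y, y + k} at most once, it meets all of them iff |S| = k, that is
-- iff |A| = k − 1.
module Submission where

open import Defs
open import Data.Nat using (ℕ; _*_; _∸_; NonZero)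
open import Data.Fin using (Fin)
open import Data.Fin.Subset using (Subset; _∈_; _∉_; ∣_∣)
open import Data.Product using (_×_)
open import Relation.Binary.PropositionalEquality using (_≡_)
open import Function.Bundles using (_⇔_)

open import Algebra.Bundles using (AbelianGroup)
open import Algebra.Consequences.Propositional using (comm∧idˡ⇒id; comm∧invˡ⇒inv)
open import Algebra.Definitions using (Commutative; Associative; LeftIdentity; LeftInverse; Involutive)
open import Algebra.Structures using (IsAbelianGroup)
open import Data.Bool using (if_then_else_)
open import Data.Fin using (zero; suc; toℕ)
open import Data.Fin.Permutation using (permutation)
open import Data.Fin.Properties using (_≟_; toℕ-injective; toℕ-fromℕ<; toℕ<n)
open import Data.Fin.Subset using (inside; outside; _∪_; _∩_; ⁅_⁆; Empty)
open import Data.Fin.Subset.Properties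
  using (_∈?_; drop-∷-Empty; ∣⁅x⁆∣≡1; x∈p∩q⁻; x∈⁅y⁆⇒x≡y; x∈⁅y⁆⇔x≡y; x∈⁅x⁆; ∪⇔⊎; x∈p∪q⁺)
open import Data.Nat using (zero; suc; _+_; _%_; _<_; _≤_; z≤n; s≤s; nonZero; >-nonZero⁻¹; ≢-nonZero⁻¹)
open import Data.Nat.DivMod using (m%n<n; %-distribˡ-+; m<n⇒m%n≡m; [m+n]%n≡m%n)
open import Data.Nat.Divisibility using (_∣_; divides; m%n≡0⇒n∣m; *-cancelˡ-∣)
open import Data.Nat.Properties
  using ( +-assoc; +-comm; +-identityʳ; +-suc; *-identityˡ; m∸n+n≡m; <⇒≤; <⇒≱; m<m+n; ≤-refl; 1+n≰n
        ; +-mono-≤; +-monoʳ-≤; suc-injective; *-cancelˡ-≡; +-0-commutativeMonoid)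
open import Algebra.Properties.CommutativeMonoid.Sum +-0-commutativeMonoid using (sum; sum-permute; ∑-distrib-+)
open import Data.Product using (_,_; proj₁; proj₂)
open import Data.Product.Function.NonDependent.Propositional using (_×-⇔_)
open import Data.Sum using (_⊎_; inj₁; inj₂; fromInj₁; fromInj₂)
open import Data.Sum.Function.Propositional using (_⊎-⇔_)
open import Data.Vec using (_∷_; []; here)
open import Function using (_∘_; mk⇔; Equivalence)
open import Function.Construct.Composition using (_⇔-∘_)
open import Function.Construct.Identity using (⇔-id)
open import Function.Construct.Symmetry using (⇔-sym)
open import Function.Properties.Equivalence using (⇔-setoid)
open import Function.Related.TypeIsomorphisms using (¬-cong-⇔)
open import Level using (0ℓ)
open import Relation.Binary.PropositionalEquality
  using (_≢_; refl; sym; trans; cong; cong₂; subst; subst₂; module ≡-Reasoning)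
open import Relation.Binary.PropositionalEquality.Algebra using (isMagma)
import Relation.Binary.Reasoning.Setoid as SetoidReasoning
open import Relation.Nullary using (Dec; yes; no; does; ¬_; contradiction)
open import Relation.Nullary.Decidable using (decidable-stable)

open Equivalence using (to; from)

module ⇔-Reasoning = SetoidReasoning (⇔-setoid 0ℓ)

2*n≡n+n : ∀ n → 2 * n ≡ n + n
2*n≡n+n n = cong (n +_) (+-identityʳ n)

∀-cong-⇔ : ∀ {a p q} {X : Set a} {P : X → Set p} {Q : X → Set q} →
           (∀ x → P x ⇔ Q x) → (∀ x → P x) ⇔ (∀ x → Q x)
∀-cong-⇔ P⇔Q = mk⇔ (λ p x → to (P⇔Q x) (p x)) (λ q x → from (P⇔Q x) (q x))

∣p∪q∣≡∣p∣+∣q∣ : ∀ {n} (p q : Subset n) → Empty (p ∩ q) → ∣ p ∪ q ∣ ≡ ∣ p ∣ + ∣ q ∣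
∣p∪q∣≡∣p∣+∣q∣ []            []            _     = refl
∣p∪q∣≡∣p∣+∣q∣ (inside  ∷ p) (inside  ∷ q) p∩q=∅ = contradiction (zero , here) p∩q=∅
∣p∪q∣≡∣p∣+∣q∣ (inside  ∷ p) (outside ∷ q) p∩q=∅ = cong suc (∣p∪q∣≡∣p∣+∣q∣ p q (drop-∷-Empty p∩q=∅))
∣p∪q∣≡∣p∣+∣q∣ (outside ∷ p) (inside  ∷ q) p∩q=∅ =
  trans (cong suc (∣p∪q∣≡∣p∣+∣q∣ p q (drop-∷-Empty p∩q=∅))) (sym (+-suc ∣ p ∣ ∣ q ∣))
∣p∪q∣≡∣p∣+∣q∣ (outside ∷ p) (outside ∷ q) p∩q=∅ = ∣p∪q∣≡∣p∣+∣q∣ p q (drop-∷-Empty p∩q=∅)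

∣⁅x⁆∪p∣≡1+∣p∣ : ∀ {n} {x : Fin n} (p : Subset n) → x ∉ p → ∣ ⁅ x ⁆ ∪ p ∣ ≡ suc ∣ p ∣
∣⁅x⁆∪p∣≡1+∣p∣ {x = x} p x∉p = trans (∣p∪q∣≡∣p∣+∣q∣ ⁅ x ⁆ p ⁅x⁆∩p=∅) (cong (_+ ∣ p ∣) (∣⁅x⁆∣≡1 x))
  where
  ⁅x⁆∩p=∅ : Empty (⁅ x ⁆ ∩ p)
  ⁅x⁆∩p=∅ (i , i∈⁅x⁆∩p) =
    let i∈⁅x⁆ , i∈p = x∈p∩q⁻ ⁅ x ⁆ p i∈⁅x⁆∩p in x∉p (subst (_∈ p) (x∈⁅y⁆⇒x≡y x i∈⁅x⁆) i∈p)

𝟙 : ∀ {a} {P : Set a} → Dec P → ℕ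
𝟙 P? = if does P? then 1 else 0

module _ {a b} {P : Set a} {Q : Set b} where

  𝟙+𝟙≤1 : (P? : Dec P) (Q? : Dec Q) → ¬ (P × Q) → 𝟙 P? + 𝟙 Q? ≤ 1
  𝟙+𝟙≤1 (yes p) (yes q) ¬P×Q = contradiction (p , q) ¬P×Q
  𝟙+𝟙≤1 (yes _) (no  _) _    = ≤-refl
  𝟙+𝟙≤1 (no  _) (yes _) _    = ≤-refl
  𝟙+𝟙≤1 (no  _) (no  _) _    = z≤n

  𝟙+𝟙≡1⇔⊎ : (P? : Dec P) (Q? : Dec Q) → ¬ (P × Q) → 𝟙 P? + 𝟙 Q? ≡ 1 ⇔ (P ⊎ Q)
  𝟙+𝟙≡1⇔⊎ (yes p) (yes q) ¬P×Q = contradiction (p , q) ¬P×Q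
  𝟙+𝟙≡1⇔⊎ (yes p) (no  _) _    = mk⇔ (λ _ → inj₁ p) (λ _ → refl)
  𝟙+𝟙≡1⇔⊎ (no  _) (yes q) _    = mk⇔ (λ _ → inj₂ q) (λ _ → refl)
  𝟙+𝟙≡1⇔⊎ (no ¬p) (no ¬q) _    =
    mk⇔ (λ ()) (λ { (inj₁ p) → contradiction p ¬p ; (inj₂ q) → contradiction q ¬q })

∣p∣≡∑𝟙∈ : ∀ {n} (p : Subset n) → ∣ p ∣ ≡ sum (λ i → 𝟙 (i ∈? p))
∣p∣≡∑𝟙∈ []            = refl
∣p∣≡∑𝟙∈ (inside  ∷ p) = cong suc (∣p∣≡∑𝟙∈ p)
∣p∣≡∑𝟙∈ (outside ∷ p) = ∣p∣≡∑𝟙∈ p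

sum-∘-involution : ∀ {n} (f : Fin n → ℕ) (τ : Fin n → Fin n) → Involutive _≡_ τ → sum (f ∘ τ) ≡ sum f
sum-∘-involution f τ τ∘τ≗id = sym (sum-permute f (permutation τ τ τ∘τ≗id τ∘τ≗id))

sum≤n : ∀ {n} (f : Fin n → ℕ) → (∀ i → f i ≤ 1) → sum f ≤ n
sum≤n {zero}  f _   = z≤n
sum≤n {suc n} f f≤1 = +-mono-≤ (f≤1 zero) (sum≤n (f ∘ suc) (f≤1 ∘ suc))

≤1+≤n≡1+n⇒≡1×≡n : ∀ {a b n} → a ≤ 1 → b ≤ n → a + b ≡ suc n → a ≡ 1 × b ≡ n
≤1+≤n≡1+n⇒≡1×≡n z≤n       b≤n refl = contradiction b≤n 1+n≰n
≤1+≤n≡1+n⇒≡1×≡n (s≤s z≤n) _   eq   = refl , suc-injective eq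

sum≡n⇒≡1 : ∀ {n} (f : Fin n → ℕ) → (∀ i → f i ≤ 1) → sum f ≡ n → ∀ i → f i ≡ 1
sum≡n⇒≡1 {suc n} f f≤1 eq i = split i
  where
  head×tail : f zero ≡ 1 × sum (f ∘ suc) ≡ n
  head×tail = ≤1+≤n≡1+n⇒≡1×≡n (f≤1 zero) (sum≤n (f ∘ suc) (f≤1 ∘ suc)) eq
  split : ∀ i → f i ≡ 1
  split zero    = proj₁ head×tail
  split (suc i) = sum≡n⇒≡1 (f ∘ suc) (f≤1 ∘ suc) (proj₂ head×tail) i

≡1⇒sum≡n : ∀ {n} (f : Fin n → ℕ) → (∀ i → f i ≡ 1) → sum f ≡ n
≡1⇒sum≡n {zero}  f _   = refl
≡1⇒sum≡n {suc n} f f≡1 = cong₂ _+_ (f≡1 zero) (≡1⇒sum≡n (f ∘ suc) (f≡1 ∘ suc))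

module _ {n : ℕ} (S : Subset n) (τ : Fin n → Fin n) where

  Disjoint : Set
  Disjoint = ∀ y → ¬ (y ∈ S × τ y ∈ S)

  Covers : Set
  Covers = ∀ y → y ∈ S ⊎ τ y ∈ S

covers⇔∣S∣+∣S∣≡n : ∀ {n} (S : Subset n) {τ : Fin n → Fin n} →
                    Involutive _≡_ τ → Disjoint S τ → Covers S τ ⇔ ∣ S ∣ + ∣ S ∣ ≡ n
covers⇔∣S∣+∣S∣≡n {n} S {τ} τ-involutive disjoint = begin
  Covers S τ          ≈⟨ ∀-cong-⇔ (λ y → ⇔-sym (pair≡1⇔ y)) ⟩
  (∀ y → pair y ≡ 1)  ≈⟨ mk⇔ (≡1⇒sum≡n pair) (sum≡n⇒≡1 pair (λ y → 𝟙+𝟙≤1 (y ∈? S) (τ y ∈? S) (disjoint y))) ⟩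
  sum pair ≡ n        ≡⟨ cong (_≡ n) sum-pair ⟩
  ∣ S ∣ + ∣ S ∣ ≡ n   ∎
  where
  open ⇔-Reasoning
  χ : Fin n → ℕ
  χ y = 𝟙 (y ∈? S)
  pair : Fin n → ℕ
  pair y = χ y + χ (τ y)
  pair≡1⇔ : ∀ y → pair y ≡ 1 ⇔ (y ∈ S ⊎ τ y ∈ S)
  pair≡1⇔ y = 𝟙+𝟙≡1⇔⊎ (y ∈? S) (τ y ∈? S) (disjoint y)
  sum-pair : sum pair ≡ ∣ S ∣ + ∣ S ∣
  sum-pair = trans (∑-distrib-+ χ (χ ∘ τ))
    (cong₂ _+_ (sym (∣p∣≡∑𝟙∈ S)) (trans (sum-∘-involution χ τ τ-involutive) (sym (∣p∣≡∑𝟙∈ S))))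

module _ {n : ℕ} .{{_ : NonZero n}} where
  open ≡-Reasoning

  toℕ-[] : ∀ m → toℕ ([_] {n} m) ≡ m % n
  toℕ-[] m = toℕ-fromℕ< (m%n<n m n)

  %≡%⇒[]≡[] : ∀ {m m′} → m % n ≡ m′ % n → [_] {n} m ≡ [ m′ ]
  %≡%⇒[]≡[] {m} {m′} eq = toℕ-injective (trans (toℕ-[] m) (trans eq (sym (toℕ-[] m′))))

  toℕ-[]-< : ∀ {m} → m < n → toℕ ([_] {n} m) ≡ m
  toℕ-[]-< {m} m<n = trans (toℕ-[] m) (m<n⇒m%n≡m m<n)

  []-injective-< : ∀ {m m′} → m < n → m′ < n → [_] {n} m ≡ [ m′ ] → m ≡ m′
  []-injective-< m<n m′<n eq = trans (sym (toℕ-[]-< m<n)) (trans (cong toℕ eq) (toℕ-[]-< m′<n))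

  [toℕ] : (x : Fin n) → [ toℕ x ] ≡ x
  [toℕ] x = toℕ-injective (trans (toℕ-[] (toℕ x)) (m<n⇒m%n≡m (toℕ<n x)))

  [n]≡[0] : [_] {n} n ≡ [ 0 ]
  [n]≡[0] = %≡%⇒[]≡[] ([m+n]%n≡m%n 0 n)

  [+]-homo : ∀ a b → [ a ] ⊕ [ b ] ≡ [_] {n} (a + b)
  [+]-homo a b = %≡%⇒[]≡[] (begin
    (toℕ ([_] {n} a) + toℕ ([_] {n} b)) % n ≡⟨ cong₂ (λ p q → (p + q) % n) (toℕ-[] a) (toℕ-[] b) ⟩
    (a % n + b % n) % n                     ≡⟨ %-distribˡ-+ a b n ⟨
    (a + b) % n                             ∎)

  ⊕-comm : Commutative _≡_ _⊕_
  ⊕-comm x y = cong [_] (+-comm (toℕ x) (toℕ y))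

  ⊕-assoc : Associative _≡_ _⊕_
  ⊕-assoc x y z = begin
    (x ⊕ y) ⊕ z                   ≡⟨ cong ((x ⊕ y) ⊕_) ([toℕ] z) ⟨
    [ toℕ x + toℕ y ] ⊕ [ toℕ z ] ≡⟨ [+]-homo _ _ ⟩
    [ toℕ x + toℕ y + toℕ z ]     ≡⟨ cong [_] (+-assoc (toℕ x) _ _) ⟩
    [ toℕ x + (toℕ y + toℕ z) ]   ≡⟨ [+]-homo _ _ ⟨
    [ toℕ x ] ⊕ (y ⊕ z)           ≡⟨ cong (_⊕ (y ⊕ z)) ([toℕ] x) ⟩
    x ⊕ (y ⊕ z)                   ∎

  ⊕-identityˡ : LeftIdentity _≡_ [ 0 ] _⊕_
  ⊕-identityˡ x = begin
    [ 0 ] ⊕ x         ≡⟨ cong ([ 0 ] ⊕_) ([toℕ] x) ⟨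
    [ 0 ] ⊕ [ toℕ x ] ≡⟨ [+]-homo 0 (toℕ x) ⟩
    [ toℕ x ]         ≡⟨ [toℕ] x ⟩
    x                 ∎

  ⊝-inverseˡ : LeftInverse _≡_ [ 0 ] ⊝_ _⊕_
  ⊝-inverseˡ x = begin
    (⊝ x) ⊕ x                 ≡⟨ cong ((⊝ x) ⊕_) ([toℕ] x) ⟨
    [ n ∸ toℕ x ] ⊕ [ toℕ x ] ≡⟨ [+]-homo (n ∸ toℕ x) (toℕ x) ⟩
    [ n ∸ toℕ x + toℕ x ]     ≡⟨ cong [_] (m∸n+n≡m (<⇒≤ (toℕ<n x))) ⟩
    [ n ]                     ≡⟨ [n]≡[0] ⟩
    [ 0 ]                     ∎

  ⊕-⊝-isAbelianGroup : IsAbelianGroup _≡_ _⊕_ [ 0 ] ⊝_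
  ⊕-⊝-isAbelianGroup = record
    { isGroup = record
      { isMonoid = record
        { isSemigroup = record { isMagma = isMagma _⊕_ ; assoc = ⊕-assoc }
        ; identity    = comm∧idˡ⇒id ⊕-comm ⊕-identityˡ
        }
      ; inverse = comm∧invˡ⇒inv ⊕-comm ⊝-inverseˡ
      ; ⁻¹-cong = cong ⊝_
      }
    ; comm = ⊕-comm
    }

  ⊕-⊝-abelianGroup : AbelianGroup _ _
  ⊕-⊝-abelianGroup = record { isAbelianGroup = ⊕-⊝-isAbelianGroup }

  ⊖-as-⊕⊝ : (u v : Fin n) → u ⊖ v ≡ u ⊕ (⊝ v)
  ⊖-as-⊕⊝ u v = begin
    u ⊖ v                     ≡⟨ [+]-homo (toℕ u) (n ∸ toℕ v) ⟨
    [ toℕ u ] ⊕ (⊝ v)         ≡⟨ cong (_⊕ (⊝ v)) ([toℕ] u) ⟩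
    u ⊕ (⊝ v)                 ∎

module _ {n : ℕ} .{{_ : NonZero n}} where
  open AbelianGroup (⊕-⊝-abelianGroup {n}) using (inverseʳ; inverseˡ; identityˡ; identityʳ; assoc)
  open import Algebra.Properties.AbelianGroup (⊕-⊝-abelianGroup {n})
    using (ε⁻¹≈ε; x∙y⁻¹≈ε⇒x≈y; ⁻¹-anti-homo‿-; xyx⁻¹≈y)
  open ≡-Reasoning

  ⊖-self : (u : Fin n) → u ⊖ u ≡ [ 0 ]
  ⊖-self u = trans (⊖-as-⊕⊝ u u) (inverseʳ u)

  ⊖≡[0]⇒≡ : (u v : Fin n) → u ⊖ v ≡ [ 0 ] → u ≡ v
  ⊖≡[0]⇒≡ u v eq = x∙y⁻¹≈ε⇒x≈y u v (trans (sym (⊖-as-⊕⊝ u v)) eq)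

  ⊖-identityʳ : (u : Fin n) → u ⊖ [ 0 ] ≡ u
  ⊖-identityʳ u = begin
    u ⊖ [ 0 ]     ≡⟨ ⊖-as-⊕⊝ u [ 0 ] ⟩
    u ⊕ (⊝ [ 0 ]) ≡⟨ cong (u ⊕_) ε⁻¹≈ε ⟩
    u ⊕ [ 0 ]     ≡⟨ identityʳ u ⟩
    u             ∎

  ⊖-⊖-cancel : (u y : Fin n) → u ⊖ (u ⊖ y) ≡ y
  ⊖-⊖-cancel u y = begin
    u ⊖ (u ⊖ y)         ≡⟨ ⊖-as-⊕⊝ u (u ⊖ y) ⟩
    u ⊕ (⊝ (u ⊖ y))     ≡⟨ cong (λ z → u ⊕ (⊝ z)) (⊖-as-⊕⊝ u y) ⟩
    u ⊕ (⊝ (u ⊕ (⊝ y))) ≡⟨ cong (u ⊕_) (⁻¹-anti-homo‿- u y) ⟩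
    u ⊕ (y ⊕ (⊝ u))     ≡⟨ assoc u y (⊝ u) ⟨
    (u ⊕ y) ⊕ (⊝ u)     ≡⟨ xyx⁻¹≈y u y ⟩
    y                   ∎

  ⊖-chain : (v u w : Fin n) → (v ⊖ u) ⊕ (u ⊖ w) ≡ v ⊖ w
  ⊖-chain v u w = begin
    (v ⊖ u) ⊕ (u ⊖ w)         ≡⟨ cong₂ _⊕_ (⊖-as-⊕⊝ v u) (⊖-as-⊕⊝ u w) ⟩
    (v ⊕ (⊝ u)) ⊕ (u ⊕ (⊝ w)) ≡⟨ assoc v (⊝ u) (u ⊕ (⊝ w)) ⟩
    v ⊕ ((⊝ u) ⊕ (u ⊕ (⊝ w))) ≡⟨ cong (v ⊕_) (assoc (⊝ u) u (⊝ w)) ⟨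
    v ⊕ (((⊝ u) ⊕ u) ⊕ (⊝ w)) ≡⟨ cong (λ z → v ⊕ (z ⊕ (⊝ w))) (inverseˡ u) ⟩
    v ⊕ ([ 0 ] ⊕ (⊝ w))       ≡⟨ cong (v ⊕_) (identityˡ (⊝ w)) ⟩
    v ⊕ (⊝ w)                 ≡⟨ ⊖-as-⊕⊝ v w ⟨
    v ⊖ w                     ∎

module _ (k : ℕ) .{{_ : NonZero k}} where
  open AbelianGroup (⊕-⊝-abelianGroup {2 * k}) using (identityˡ; assoc)
  open ≡-Reasoning

  k<2k : k < 2 * k
  k<2k = subst (k <_) (sym (2*n≡n+n k)) (m<m+n k (>-nonZero⁻¹ k))

  0<2k : 0 < 2 * k
  0<2k = >-nonZero⁻¹ (2 * k)

  [k]≢[0] : [_] {2 * k} k ≢ [ 0 ]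
  [k]≢[0] eq = ≢-nonZero⁻¹ k ([]-injective-< k<2k 0<2k eq)

  [k]⊕[k]≡[0] : [_] {2 * k} k ⊕ [ k ] ≡ [ 0 ]
  [k]⊕[k]≡[0] = begin
    [ k ] ⊕ [ k ] ≡⟨ [+]-homo k k ⟩
    [ k + k ]     ≡⟨ cong [_] (2*n≡n+n k) ⟨
    [ 2 * k ]     ≡⟨ [n]≡[0] ⟩
    [ 0 ]         ∎

  [k]⊕-involutive : Involutive _≡_ ([_] {2 * k} k ⊕_)
  [k]⊕-involutive y = begin
    [ k ] ⊕ ([ k ] ⊕ y) ≡⟨ assoc [ k ] [ k ] y ⟨
    ([ k ] ⊕ [ k ]) ⊕ y ≡⟨ cong (_⊕ y) [k]⊕[k]≡[0] ⟩
    [ 0 ] ⊕ y           ≡⟨ identityˡ y ⟩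
    y                   ∎

  -- Instance search for NonZero 2 loops through Defs.nonZero-2*, hence the explicit ⦃ nonZero ⦄ here and below.
  x⊕x≡[0]⇒k∣x : (x : Fin (2 * k)) → x ⊕ x ≡ [ 0 ] → k ∣ toℕ x
  x⊕x≡[0]⇒k∣x x x⊕x≡0 = *-cancelˡ-∣ 2 ⦃ nonZero ⦄ (subst (2 * k ∣_) (sym (2*n≡n+n t)) 2k∣t+t)
    where
    t : ℕ
    t = toℕ x
    2k∣t+t : 2 * k ∣ t + t
    2k∣t+t = m%n≡0⇒n∣m (t + t) (2 * k)
      (trans (sym (toℕ-[] (t + t))) (trans (cong toℕ x⊕x≡0) (toℕ-[]-< 0<2k)))

  x⊕x≡[0]⇒x≡[0]⊎x≡[k] : (x : Fin (2 * k)) → x ⊕ x ≡ [ 0 ] → x ≡ [ 0 ] ⊎ x ≡ [ k ]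
  x⊕x≡[0]⇒x≡[0]⊎x≡[k] x x⊕x≡0 with x⊕x≡[0]⇒k∣x x x⊕x≡0
  ... | divides 0 t≡0 = inj₁ (trans (sym ([toℕ] x)) (cong [_] t≡0))
  ... | divides 1 t≡k = inj₂ (trans (sym ([toℕ] x)) (cong [_] (trans t≡k (*-identityˡ k))))
  ... | divides (suc (suc q)) t≡[2+q]k =
    contradiction (subst (2 * k ≤_) (sym t≡[2+q]k) (+-monoʳ-≤ k (+-monoʳ-≤ k z≤n))) (<⇒≱ (toℕ<n x))

module _ {n : ℕ} .{{_ : NonZero n}} where
  open AbelianGroup (⊕-⊝-abelianGroup {n}) using (assoc; identityʳ)

  module _ (S : Subset n) (d : Fin n) (disjoint : Disjoint S (d ⊕_)) where

    disjoint⇒≢[0] : [ 0 ] ∈ S → d ≢ [ 0 ]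
    disjoint⇒≢[0] [0]∈S d≡[0] = disjoint [ 0 ] ([0]∈S , subst (_∈ S) (sym (trans (identityʳ d) d≡[0])) [0]∈S)

    disjoint∧covers⇒periodic : Covers S (d ⊕_) → ∀ y → y ∈ S ⇔ (d ⊕ d) ⊕ y ∈ S
    disjoint∧covers⇒periodic covers y = mk⇔ to′ from′
      where
      to′ : y ∈ S → (d ⊕ d) ⊕ y ∈ S
      to′ y∈S = subst (_∈ S) (sym (assoc d d y))
        (fromInj₂ (λ d⊕y∈S → contradiction (y∈S , d⊕y∈S) (disjoint y)) (covers (d ⊕ y)))
      from′ : (d ⊕ d) ⊕ y ∈ S → y ∈ S
      from′ [d⊕d]⊕y∈S = fromInj₁
        (λ d⊕y∈S → contradiction (d⊕y∈S , subst (_∈ S) (assoc d d y) [d⊕d]⊕y∈S) (disjoint (d ⊕ y)))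
        (covers y)

  ∀-⊖-reindex : (R : Fin n → Fin n → Set) (u v : Fin n) →
                (∀ w → R (u ⊖ w) (v ⊖ w)) ⇔ (∀ y → R y ((v ⊖ u) ⊕ y))
  ∀-⊖-reindex R u v = mk⇔
    (λ h y → subst₂ R (⊖-⊖-cancel u y)
      (trans (sym (⊖-chain v u (u ⊖ y))) (cong ((v ⊖ u) ⊕_) (⊖-⊖-cancel u y))) (h (u ⊖ y)))
    (λ h w → subst (R (u ⊖ w)) (⊖-chain v u w) (h (u ⊖ w)))

  module _ (A : Subset n) where

    withZero : Subset n
    withZero = ⁅ [ 0 ] ⁆ ∪ A

    [0]∈withZero : [ 0 ] ∈ withZero
    [0]∈withZero = x∈p∪q⁺ (inj₁ (x∈⁅x⁆ [ 0 ]))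

    ∈withZero⇔ : ∀ {y} → y ∈ withZero ⇔ (y ≡ [ 0 ] ⊎ y ∈ A)
    ∈withZero⇔ = (x∈⁅y⁆⇔x≡y ⊎-⇔ ⇔-id _) ⇔-∘ ∪⇔⊎

    ∈N[]⇔⊖∈withZero : ∀ u w → InClosedNbhd A u w ⇔ (u ⊖ w) ∈ withZero
    ∈N[]⇔⊖∈withZero u w = ⇔-sym ∈withZero⇔ ⇔-∘ (w≡u⇔u⊖w≡[0] ⊎-⇔ ⇔-id _)
      where
      w≡u⇔u⊖w≡[0] : w ≡ u ⇔ u ⊖ w ≡ [ 0 ]
      w≡u⇔u⊖w≡[0] = mk⇔ (λ { refl → ⊖-self u }) (sym ∘ ⊖≡[0]⇒≡ u w)

    SplitBy : Fin n → Set
    SplitBy d = Disjoint withZero (d ⊕_) × Covers withZero (d ⊕_)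

    coTwins⇔splitBy : ∀ u v →
      ((∀ w → ¬ (InClosedNbhd A u w × InClosedNbhd A v w)) × (∀ w → InClosedNbhd A u w ⊎ InClosedNbhd A v w))
      ⇔ SplitBy (v ⊖ u)
    coTwins⇔splitBy u v =
      (∀-⊖-reindex (λ x y → ¬ (x ∈ withZero × y ∈ withZero)) u v
        ⇔-∘ ∀-cong-⇔ (λ w → ¬-cong-⇔ (∈N[]⇔⊖∈withZero u w ×-⇔ ∈N[]⇔⊖∈withZero v w)))
      ×-⇔
      (∀-⊖-reindex (λ x y → x ∈ withZero ⊎ y ∈ withZero) u v
        ⇔-∘ ∀-cong-⇔ (λ w → ∈N[]⇔⊖∈withZero u w ⊎-⇔ ∈N[]⇔⊖∈withZero v w))

    periodic⇒closedTwins : ∀ e → (∀ y → y ∈ withZero ⇔ e ⊕ y ∈ withZero) →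
                           ∀ w → InClosedNbhd A [ 0 ] w ⇔ InClosedNbhd A e w
    periodic⇒closedTwins e periodic w = begin
      InClosedNbhd A [ 0 ] w     ≈⟨ ∈N[]⇔⊖∈withZero [ 0 ] w ⟩
      [ 0 ] ⊖ w ∈ withZero       ≈⟨ periodic ([ 0 ] ⊖ w) ⟩
      e ⊕ ([ 0 ] ⊖ w) ∈ withZero ≡⟨ cong (_∈ withZero) e⊕[0⊖w]≡e⊖w ⟩
      e ⊖ w ∈ withZero           ≈⟨ ∈N[]⇔⊖∈withZero e w ⟨
      InClosedNbhd A e w         ∎
      where
      open ⇔-Reasoning
      e⊕[0⊖w]≡e⊖w : e ⊕ ([ 0 ] ⊖ w) ≡ e ⊖ w
      e⊕[0⊖w]≡e⊖w = trans (cong (_⊕ ([ 0 ] ⊖ w)) (sym (⊖-identityʳ e))) (⊖-chain e [ 0 ] w)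

    twinFree⇒aperiodic : TwinFree A → ∀ e → (∀ y → y ∈ withZero ⇔ e ⊕ y ∈ withZero) → e ≡ [ 0 ]
    twinFree⇒aperiodic (_ , noClosedTwins) e periodic = decidable-stable (e ≟ [ 0 ])
      (λ e≢[0] → noClosedTwins [ 0 ] e (e≢[0] ∘ sym) (periodic⇒closedTwins e periodic))

1+m+1+m≡2k⇔m≡k∸1 : ∀ m k .{{_ : NonZero k}} → suc m + suc m ≡ 2 * k ⇔ m ≡ k ∸ 1
1+m+1+m≡2k⇔m≡k∸1 m (suc k) = mk⇔
  (λ eq → suc-injective (*-cancelˡ-≡ (suc m) (suc k) 2 ⦃ nonZero ⦄ (trans (2*n≡n+n (suc m)) eq)))
  (λ { refl → sym (2*n≡n+n (suc k)) })

module _ (k : ℕ) .{{_ : NonZero k}} (A : Subset (2 * k)) where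
  open AbelianGroup (⊕-⊝-abelianGroup {2 * k}) using (identityʳ)

  splitBy⇒≡[k] : TwinFree A → ∀ d → SplitBy A d → d ≡ [ k ]
  splitBy⇒≡[k] twinFree d (disjoint , covers) = fromInj₂
    (λ d≡[0] → contradiction d≡[0] (disjoint⇒≢[0] (withZero A) d disjoint ([0]∈withZero A)))
    (x⊕x≡[0]⇒x≡[0]⊎x≡[k] k d
      (twinFree⇒aperiodic A twinFree (d ⊕ d) (disjoint∧covers⇒periodic (withZero A) d disjoint covers)))

  hasCoTwins⇔splitBy[k] : TwinFree A → HasCoTwins A ⇔ SplitBy A [ k ]
  hasCoTwins⇔splitBy[k] twinFree = mk⇔
    (λ (u , v , _ , coTwins) →
      let split = to (coTwins⇔splitBy A u v) coTwins
      in  subst (SplitBy A) (splitBy⇒≡[k] twinFree (v ⊖ u) split) split)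
    (λ split → [ 0 ] , [ k ] , [k]≢[0] k ∘ sym ,
      from (coTwins⇔splitBy A [ 0 ] [ k ]) (subst (SplitBy A) (sym (⊖-identityʳ [ k ])) split))

  disjoint⇔[k]∉A×[k]⊕A⊆Ā : Disjoint (withZero A) ([ k ] ⊕_) ⇔ ([ k ] ∉ A × (∀ a → a ∈ A → InCompl A ([ k ] ⊕ a)))
  disjoint⇔[k]∉A×[k]⊕A⊆Ā = mk⇔
    (λ disjoint →
      (λ k∈A → disjoint [ 0 ] ([0]∈withZero A , subst (_∈ S) (sym (identityʳ [ k ])) (A⊆S k∈A))) ,
      (λ a a∈A → (λ k⊕a≡0 → disjoint a (A⊆S a∈A , from (∈withZero⇔ A) (inj₁ k⊕a≡0))) ,
                 (λ k⊕a∈A → disjoint a (A⊆S a∈A , A⊆S k⊕a∈A))))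
    (λ ([k]∉A , [k]⊕A⊆Ā) y (y∈S , k⊕y∈S) →
      excluded [k]∉A [k]⊕A⊆Ā (to (∈withZero⇔ A) y∈S) (to (∈withZero⇔ A) k⊕y∈S))
    where
    S : Subset (2 * k)
    S = withZero A
    A⊆S : ∀ {y} → y ∈ A → y ∈ S
    A⊆S y∈A = x∈p∪q⁺ (inj₂ y∈A)
    excluded : [ k ] ∉ A → (∀ a → a ∈ A → InCompl A ([ k ] ⊕ a)) →
               ∀ {y} → y ≡ [ 0 ] ⊎ y ∈ A → ¬ ([ k ] ⊕ y ≡ [ 0 ] ⊎ [ k ] ⊕ y ∈ A)
    excluded _     _       (inj₁ refl) (inj₁ k⊕0≡0) = [k]≢[0] k (trans (sym (identityʳ [ k ])) k⊕0≡0)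
    excluded [k]∉A _       (inj₁ refl) (inj₂ k⊕0∈A) = [k]∉A (subst (_∈ A) (identityʳ [ k ]) k⊕0∈A)
    excluded _     [k]⊕A⊆Ā (inj₂ y∈A)  (inj₁ k⊕y≡0) = proj₁ ([k]⊕A⊆Ā _ y∈A) k⊕y≡0
    excluded _     [k]⊕A⊆Ā (inj₂ y∈A)  (inj₂ k⊕y∈A) = proj₂ ([k]⊕A⊆Ā _ y∈A) k⊕y∈A

  covers⇔∣A∣≡k∸1 : [ 0 ] ∉ A → Disjoint (withZero A) ([ k ] ⊕_) →
                   Covers (withZero A) ([ k ] ⊕_) ⇔ ∣ A ∣ ≡ k ∸ 1
  covers⇔∣A∣≡k∸1 [0]∉A disjoint = begin
    Covers (withZero A) ([ k ] ⊕_)          ≈⟨ covers⇔∣S∣+∣S∣≡n (withZero A) ([k]⊕-involutive k) disjoint ⟩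
    ∣ withZero A ∣ + ∣ withZero A ∣ ≡ 2 * k ≡⟨ cong (λ m → m + m ≡ 2 * k) (∣⁅x⁆∪p∣≡1+∣p∣ A [0]∉A) ⟩
    suc ∣ A ∣ + suc ∣ A ∣ ≡ 2 * k           ≈⟨ 1+m+1+m≡2k⇔m≡k∸1 ∣ A ∣ k ⟩
    ∣ A ∣ ≡ k ∸ 1                           ∎
    where open ⇔-Reasoning

lemma30 : (k : ℕ) → .{{_ : NonZero k}} → (A : Subset (2 * k)) →
          [ 0 ] ∉ A →
          (∀ a → a ∈ A → (⊝ a) ∈ A) →
          TwinFree A →
          (HasCoTwins A ⇔
            (([ k ] ∉ A) × (∣ A ∣ ≡ k ∸ 1) × (∀ a → a ∈ A → InCompl A ([ k ] ⊕ a))))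
lemma30 k A [0]∉A _ twinFree = mk⇔
  (λ coTwins →
    let disjoint , covers = to (hasCoTwins⇔splitBy[k] k A twinFree) coTwins
        [k]∉A , [k]⊕A⊆Ā   = to (disjoint⇔[k]∉A×[k]⊕A⊆Ā k A) disjoint
    in  [k]∉A , to (covers⇔∣A∣≡k∸1 k A [0]∉A disjoint) covers , [k]⊕A⊆Ā)
  (λ ([k]∉A , ∣A∣≡k∸1 , [k]⊕A⊆Ā) →
    let disjoint = from (disjoint⇔[k]∉A×[k]⊕A⊆Ā k A) ([k]∉A , [k]⊕A⊆Ā)
    in  from (hasCoTwins⇔splitBy[k] k A twinFree) (disjoint , from (covers⇔∣A∣≡k∸1 k A [0]∉A disjoint) ∣A∣≡k∸1))
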